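{- Let $\mathbf G$ be a finite abelian group, $m,n$ positive integers, $m_1,\dots,m_n$ positive integers with $m_1+\dots+m_n=m$, and let $A\subseteq\mathbf G^m$, $B,C\subseteq\mathbf G^n$. Then $$|C|\,|A-\Delta_{m_1,\dots,m_n;n}(B)|\leqslant |A\times_{m_1,\dots,m_n}B-\Delta_{m_1+1,\dots,m_n+1;n}(C)|,$$ $$|A\times_{m_1,\dots,m_n}B-\Delta_{m_1+1,\dots,m_n+1;n}(C)|=|A\times_{m_1,\dots,m_n}C-\Delta_{m_1+1,\dots,m_n+1;n}(B)|,$$ and, for each choice of sign $\pm$ (the same throughout), $$|C|\,|A\pm\Delta_{m_1,\dots,m_n;n}(B)|\leqslant|A\pm\Delta_{m_1,\dots,m_n;n}(C)|\,|B\pm C|.$$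
   Context: Sums/differences of subsets of $\mathbf G^k$ are taken coordinatewise: $X\pm Y=\{x\pm y:x\in X,y\in Y\}$. For $x\in\mathbf G$, $\Delta_k(x)=(x,\dots,x)\in\mathbf G^k$. Each $a\in\mathbf G^m$ is written as $a=(a_1,\dots,a_n)$ with $a_i\in\mathbf G^{m_i}$ consecutive blocks. Define $A\times_{m_1,\dots,m_n}B=\{(a_1,b_1,a_2,b_2,\dots,a_n,b_n): (a_1,\dots,a_n)\in A,\ (b_1,\dots,b_n)\in B\}\subseteq\mathbf G^{m+n}$ and $\Delta_{m_1,\dots,m_n;n}(B)=\{(\Delta_{m_1}(b_1),\dots,\Delta_{m_n}(b_n)):(b_1,\dots,b_n)\in B\}\subseteq\mathbf G^m$. -}

module Defs where

open import Data.Nat using (ℕ; zero; suc; _+_; _*_; _≤_)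
open import Data.Fin using (Fin)
import Data.Fin.Properties as FinP
open import Data.Bool using (Bool; true; false; _∧_)
open import Data.List using (List; []; _∷_; map; concatMap; filter; length; allFin)
open import Data.Bool.ListAction using (any)
open import Data.Vec using (Vec; []; _∷_; zipWith; replicate; _++_; take; drop)
import Data.Vec.Properties as VecP
open import Data.Product using (_×_; _,_)
open import Relation.Binary.PropositionalEquality using (_≡_)
open import Relation.Nullary.Decidable using (⌊_⌋)
open import Algebra.Structures using (IsAbelianGroup)

-- A finite abelian group, presented (up to isomorphism) with carrier Fin N
-- and propositional equality.
record FinAbGroup : Set where
  field
    N : ℕ
    _⊕_ : Fin N → Fin N → Fin N
    ε : Fin N
    ⊖_ : Fin N → Fin N
    isAbelianGroup : IsAbelianGroup _≡_ _⊕_ ε ⊖_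

module Ops (𝔾 : FinAbGroup) where
  open FinAbGroup 𝔾

  G : Set
  G = Fin N

  Pow : ℕ → Set
  Pow k = Vec G k

  Subset : ℕ → Set
  Subset k = Pow k → Bool

  allPow : (k : ℕ) → List (Pow k)
  allPow zero = [] ∷ []
  allPow (suc k) = concatMap (λ x → map (x ∷_) (allPow k)) (allFin N)

  _==_ : ∀ {k} → Pow k → Pow k → Bool
  x == y = ⌊ VecP.≡-dec FinP._≟_ x y ⌋

  card : ∀ {k} → Subset k → ℕ
  card {k} X = length (filter (λ x → Data.Bool._≟_ (X x) true) (allPow k))

  _+ᵛ_ : ∀ {k} → Pow k → Pow k → Pow k
  _+ᵛ_ = zipWith _⊕_

  _-ᵛ_ : ∀ {k} → Pow k → Pow k → Pow k
  _-ᵛ_ = zipWith (λ x y → x ⊕ (⊖ y))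

  _+ˢ_ : ∀ {k} → Subset k → Subset k → Subset k
  _+ˢ_ {k} X Y z = any (λ x → any (λ y → X x ∧ Y y ∧ ((x +ᵛ y) == z)) (allPow k)) (allPow k)

  _-ˢ_ : ∀ {k} → Subset k → Subset k → Subset k
  _-ˢ_ {k} X Y z = any (λ x → any (λ y → X x ∧ Y y ∧ ((x -ᵛ y) == z)) (allPow k)) (allPow k)

  -- block sizes (m₁,…,mₙ); m = sum ms
  sumV : ∀ {n} → Vec ℕ n → ℕ
  sumV [] = 0
  sumV (k ∷ ks) = k + sumV ks

  incr : ∀ {n} → Vec ℕ n → Vec ℕ n
  incr [] = []
  incr (k ∷ ks) = (k + 1) ∷ incr ks

  diagV : ∀ {n} (ms : Vec ℕ n) → Pow n → Pow (sumV ms)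
  diagV [] [] = []
  diagV (k ∷ ks) (b ∷ bs) = replicate k b ++ diagV ks bs

  interleave : ∀ {n} (ms : Vec ℕ n) → Pow (sumV ms) → Pow n → Pow (sumV (incr ms))
  interleave [] [] [] = []
  interleave (k ∷ ks) a (b ∷ bs) =
    (take k a ++ (b ∷ [])) ++ interleave ks (drop k a) bs

  Diag : ∀ {n} (ms : Vec ℕ n) → Subset n → Subset (sumV ms)
  Diag {n} ms B z = any (λ b → B b ∧ (diagV ms b == z)) (allPow n)

  Prod : ∀ {n} (ms : Vec ℕ n) → Subset (sumV ms) → Subset n → Subset (sumV (incr ms))
  Prod {n} ms A B z =
    any (λ a → any (λ b → A a ∧ B b ∧ (interleave ms a b == z)) (allPow n)) (allPow (sumV ms))

-- Write Δ = Δ_{m₁,…,mₙ;n}, Δ⁺ = Δ_{m₁+1,…,mₙ+1;n} and × for ×_{m₁,…,mₙ}.  The two difference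
-- inequalities come from one injection.  Fix for every x ∈ A − ΔB a representation x = a − Δb; then
-- (c , x) ↦ (a − Δc , b − c) is injective on C × (A − ΔB), because x = (a − Δc) − Δ(b − c) and
-- c = b − (b − c).  It lands in (A − ΔC) × (B − C), and after interleaving in A × B − Δ⁺C, as the
-- interleaving of (a − Δc , b − c) is that of (a , b) minus Δ⁺c.  The equality holds because the
-- interleaving of (u , v) ↦ the interleaving of (u − Δv , −v) is an involution exchanging
-- A × B − Δ⁺C and A × C − Δ⁺B.
-- The sum inequality rests on Petridis' lemma: a nonempty X ⊆ ΔC minimising ∣A + X∣ / ∣X∣ satisfies
-- ∣X∣ ∣(A + X) + Z∣ ≤ ∣A + X∣ ∣X + Z∣ for every Z.  Take Z = ΔB: translating by an element of X gives
-- ∣A + ΔB∣ ≤ ∣(A + X) + ΔB∣, the inclusion X + ΔB ⊆ Δ(C + B) gives ∣X + ΔB∣ ≤ ∣B + C∣ (Δ is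
-- injective as all mᵢ ≥ 1), and ∣A + X∣ / ∣X∣ ≤ ∣A + ΔC∣ / ∣ΔC∣ with ∣C∣ ≤ ∣ΔC∣.

module Submission where

open import Defs
open import Data.Nat using (ℕ; _≤_; _*_)
open import Data.Vec using (Vec)
open import Data.Vec.Relation.Unary.All using (All)
open import Data.Product using (_×_; _,_)
open import Relation.Binary.PropositionalEquality using (_≡_)

module Counting where

  open import Data.Bool using (Bool; true; false; T; _∧_; _∨_; not)
  open import Data.Bool.Properties using (T-≡; T-∧)
  import Data.Bool as Bool
  open import Data.Nat using (ℕ; suc; _+_; _*_; _≤_; _<_; z≤n; s≤s)
  open import Data.Nat.Properties using (≤-antisym; +-suc; n≤0⇒n≡0; m<m+n; +-mono-≤; module ≤-Reasoning)
  open import Data.List using (List; []; _∷_; _++_; map; filter; length; cartesianProduct)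
  open import Data.List.Properties using (length-removeAt′; length-++; filter-++; filter-some)
  open import Data.List.Membership.Propositional using (_∈_; _─_; lose)
  open import Data.List.Membership.Propositional.Properties using (∈-filter⁺; ∈-filter⁻; ∈-cartesianProduct⁺)
  open import Data.List.Relation.Unary.Any using (here; there; index; satisfied; any?)
  import Data.List.Relation.Unary.All as All
  open import Data.List.Relation.Unary.AllPairs using (_∷_)
  open import Data.List.Relation.Unary.Unique.Propositional using (Unique)
  import Data.List.Relation.Unary.Unique.Propositional.Properties as Unique
  open import Data.Product using (∃; _×_; _,_; proj₁; proj₂)
  open import Data.Empty using (⊥-elim)
  open import Function using (_∘_; id; Equivalence)
  open import Relation.Binary.PropositionalEquality
  open import Relation.Nullary using (¬_; yes; no; contradiction)
  open import Relation.Nullary.Decidable using (T?)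
  open import Relation.Unary using (Decidable)

  private variable
    A B : Set

  T-∧⁺ : ∀ {a b} → T a → T b → T (a ∧ b)
  T-∧⁺ Ta Tb = Equivalence.from T-∧ (Ta , Tb)

  T-∧⁻ : ∀ a {b} → T (a ∧ b) → T a × T b
  T-∧⁻ a = Equivalence.to T-∧

  T-not-∨⁺ : ∀ a {b} → (T a → T b) → T (not a ∨ b)
  T-not-∨⁺ true Ta⇒Tb = Ta⇒Tb _
  T-not-∨⁺ false _ = _

  T-not-∨⁻ : ∀ a {b} → T (not a ∨ b) → T a → T b
  T-not-∨⁻ true Tb _ = Tb

  ¬T⇒T-not : ∀ {a} → ¬ T a → T (not a)
  ¬T⇒T-not {true} ¬Ta = ¬Ta _
  ¬T⇒T-not {false} _ = _

  ∈-─ : ∀ {x y : A} {ys} (x∈ys : x ∈ ys) → y ∈ ys → y ≢ x → y ∈ ys ─ x∈ys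
  ∈-─ (here refl) (here refl) y≢x = contradiction refl y≢x
  ∈-─ (here refl) (there y∈ys) _ = y∈ys
  ∈-─ (there x∈ys) (here refl) _ = here refl
  ∈-─ (there x∈ys) (there y∈ys) y≢x = there (∈-─ x∈ys y∈ys y≢x)

  -- Remove f x from ys; by injectivity the images of the other elements survive the removal.
  length-≤-injection : ∀ {xs ys} (f : A → B) → Unique xs →
    (∀ {x} → x ∈ xs → f x ∈ ys) →
    (∀ {x y} → x ∈ xs → y ∈ xs → f x ≡ f y → x ≡ y) →
    length xs ≤ length ys
  length-≤-injection {xs = []} f _ _ _ = z≤n
  length-≤-injection {xs = x ∷ xs} {ys} f (x∉xs ∷ unique) maps inj =
    subst (suc (length xs) ≤_) (sym (length-removeAt′ ys (index fx∈ys)))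
      (s≤s (length-≤-injection f unique maps′ (λ p q → inj (there p) (there q))))
    where
    fx∈ys = maps (here refl)
    maps′ : ∀ {y} → y ∈ xs → f y ∈ ys ─ fx∈ys
    maps′ y∈xs = ∈-─ fx∈ys (maps (there y∈xs))
      (λ fy≡fx → All.lookup x∉xs y∈xs (sym (inj (there y∈xs) (here refl) fy≡fx)))

  accepts? : (P : A → Bool) → Decidable (λ x → P x ≡ true)
  accepts? P x = P x Bool.≟ true

  countIn : (A → Bool) → List A → ℕ
  countIn P xs = length (filter (accepts? P) xs)

  countIn-const-false : (xs : List A) → countIn (λ _ → false) xs ≡ 0
  countIn-const-false [] = refl
  countIn-const-false (x ∷ xs) = countIn-const-false xs

  countIn-split : ∀ (P Q : A → Bool) xs →
    countIn P xs ≡ countIn (λ x → P x ∧ Q x) xs + countIn (λ x → P x ∧ not (Q x)) xs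
  countIn-split P Q [] = refl
  countIn-split P Q (x ∷ xs) with P x | Q x
  ... | true | true = cong suc (countIn-split P Q xs)
  ... | true | false = trans (cong suc (countIn-split P Q xs)) (sym (+-suc _ _))
  ... | false | _ = countIn-split P Q xs

  countIn-∪-∩ : ∀ (P Q : A → Bool) xs →
    countIn (λ x → P x ∨ Q x) xs + countIn (λ x → P x ∧ Q x) xs ≡ countIn P xs + countIn Q xs
  countIn-∪-∩ P Q [] = refl
  countIn-∪-∩ P Q (x ∷ xs) with P x | Q x
  ... | true | true = cong suc (trans (+-suc _ _) (trans (cong suc (countIn-∪-∩ P Q xs)) (sym (+-suc _ _))))
  ... | true | false = cong suc (countIn-∪-∩ P Q xs)
  ... | false | true = trans (cong suc (countIn-∪-∩ P Q xs)) (sym (+-suc _ _))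
  ... | false | false = countIn-∪-∩ P Q xs

  _×ᵇ_ : (A → Bool) → (B → Bool) → A × B → Bool
  (P ×ᵇ Q) p = P (proj₁ p) ∧ Q (proj₂ p)

  ×ᵇ⁻ : ∀ (P : A → Bool) (Q : B → Bool) {p} → T ((P ×ᵇ Q) p) → T (P (proj₁ p)) × T (Q (proj₂ p))
  ×ᵇ⁻ P Q {p} = T-∧⁻ (P (proj₁ p))

  module _ (P : A → Bool) (Q : B → Bool) where

    private
      countIn-row : ∀ x ys → countIn (P ×ᵇ Q) (map (x ,_) ys) ≡ countIn (λ y → P x ∧ Q y) ys
      countIn-row x [] = refl
      countIn-row x (y ∷ ys) with P x ∧ Q y
      ... | true = cong suc (countIn-row x ys)
      ... | false = countIn-row x ys

      countIn-row-+ : ∀ x xs ys →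
        countIn (λ y → P x ∧ Q y) ys + countIn P xs * countIn Q ys ≡ countIn P (x ∷ xs) * countIn Q ys
      countIn-row-+ x xs ys with P x
      ... | true = refl
      ... | false = cong (_+ countIn P xs * countIn Q ys) (countIn-const-false ys)

    countIn-cartesianProduct : ∀ xs ys →
      countIn (P ×ᵇ Q) (cartesianProduct xs ys) ≡ countIn P xs * countIn Q ys
    countIn-cartesianProduct [] ys = refl
    countIn-cartesianProduct (x ∷ xs) ys = begin
      countIn (P ×ᵇ Q) (map (x ,_) ys ++ cartesianProduct xs ys)
        ≡⟨ cong length (filter-++ (accepts? (P ×ᵇ Q)) (map (x ,_) ys) _) ⟩
      length (filter (accepts? (P ×ᵇ Q)) (map (x ,_) ys) ++ filter (accepts? (P ×ᵇ Q)) (cartesianProduct xs ys))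
        ≡⟨ length-++ (filter (accepts? (P ×ᵇ Q)) (map (x ,_) ys)) ⟩
      countIn (P ×ᵇ Q) (map (x ,_) ys) + countIn (P ×ᵇ Q) (cartesianProduct xs ys)
        ≡⟨ cong₂ _+_ (countIn-row x ys) (countIn-cartesianProduct xs ys) ⟩
      countIn (λ y → P x ∧ Q y) ys + countIn P xs * countIn Q ys
        ≡⟨ countIn-row-+ x xs ys ⟩
      countIn P (x ∷ xs) * countIn Q ys ∎
      where open ≡-Reasoning

  record Enumeration (A : Set) : Set where
    field
      elements : List A
      unique : Unique elements
      complete : ∀ x → x ∈ elements

  open Enumeration

  count : Enumeration A → (A → Bool) → ℕ
  count E P = countIn P (elements E)

  _×ᴱ_ : Enumeration A → Enumeration B → Enumeration (A × B)
  EA ×ᴱ EB = record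
    { elements = cartesianProduct (elements EA) (elements EB)
    ; unique = Unique.cartesianProduct⁺ (unique EA) (unique EB)
    ; complete = λ (x , y) → ∈-cartesianProduct⁺ (complete EA x) (complete EB y)
    }

  count-× : (EA : Enumeration A) (EB : Enumeration B) (P : A → Bool) (Q : B → Bool) →
    count (EA ×ᴱ EB) (P ×ᵇ Q) ≡ count EA P * count EB Q
  count-× EA EB P Q = countIn-cartesianProduct P Q (elements EA) (elements EB)

  count-injection : (EA : Enumeration A) (EB : Enumeration B) (P : A → Bool) (Q : B → Bool) (f : A → B) →
    (∀ {x} → T (P x) → T (Q (f x))) →
    (∀ {x y} → T (P x) → T (P y) → f x ≡ f y → x ≡ y) →
    count EA P ≤ count EB Q
  count-injection EA EB P Q f maps inj =
    length-≤-injection f (Unique.filter⁺ (accepts? P) (unique EA))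
      (λ x∈ → ∈-filter⁺ (accepts? Q) (complete EB _) (Equivalence.to T-≡ (maps (holds x∈))))
      (λ x∈ y∈ → inj (holds x∈) (holds y∈))
    where
    holds : ∀ {x} → x ∈ filter (accepts? P) (elements EA) → T (P x)
    holds = Equivalence.from T-≡ ∘ proj₂ ∘ ∈-filter⁻ (accepts? P) {xs = elements EA}

  module _ (E : Enumeration A) where

    count-mono : ∀ P Q → (∀ {x} → T (P x) → T (Q x)) → count E P ≤ count E Q
    count-mono P Q P⊆Q = count-injection E E P Q id P⊆Q (λ _ _ → id)

    count-cong : ∀ P Q → (∀ {x} → T (P x) → T (Q x)) → (∀ {x} → T (Q x) → T (P x)) → count E P ≡ count E Q
    count-cong P Q P⊆Q Q⊆P = ≤-antisym (count-mono P Q P⊆Q) (count-mono Q P Q⊆P)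

    count-none : ∀ P → (∀ {x} → ¬ T (P x)) → count E P ≡ 0
    count-none P none = n≤0⇒n≡0
      (subst (count E P ≤_) (countIn-const-false (elements E)) (count-mono P (λ _ → false) (⊥-elim ∘ none)))

    count-pos : ∀ P {x} → T (P x) → 0 < count E P
    count-pos P {x} Px = filter-some (accepts? P) (lose (complete E x) (Equivalence.to T-≡ Px))

    count-witness : ∀ P → 0 < count E P → ∃ λ x → T (P x)
    count-witness P pos with filter (accepts? P) (elements E) in eq
    ... | x ∷ _ = x , Equivalence.from T-≡ (proj₂ (∈-filter⁻ (accepts? P) {xs = elements E} x∈))
      where
      x∈ : x ∈ filter (accepts? P) (elements E)
      x∈ = subst (x ∈_) (sym eq) (here refl)

    count-< : ∀ P Q {x} → (∀ {y} → T (P y) → T (Q y)) → T (Q x) → ¬ T (P x) → count E P < count E Q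
    count-< P Q {x} P⊆Q Qx ¬Px = begin-strict
      count E P
        ≡⟨ count-cong P (λ y → Q y ∧ P y) (λ Py → T-∧⁺ (P⊆Q Py) Py) (proj₂ ∘ T-∧⁻ (Q _)) ⟩
      count E (λ y → Q y ∧ P y)
        <⟨ m<m+n _ (count-pos (λ y → Q y ∧ not (P y)) (T-∧⁺ Qx (¬T⇒T-not ¬Px))) ⟩
      count E (λ y → Q y ∧ P y) + count E (λ y → Q y ∧ not (P y))
        ≡⟨ countIn-split Q P (elements E) ⟨
      count E Q ∎
      where open ≤-Reasoning

    count-≤-∪-∩ : ∀ U V P Q → (∀ {x} → T (U x) → T (P x ∨ Q x)) → (∀ {x} → T (V x) → T (P x ∧ Q x)) →
      count E U + count E V ≤ count E P + count E Q
    count-≤-∪-∩ U V P Q U⊆P∪Q V⊆P∩Q = begin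
      count E U + count E V                                  ≤⟨ +-mono-≤ (count-mono U _ U⊆P∪Q) (count-mono V _ V⊆P∩Q) ⟩
      count E (λ x → P x ∨ Q x) + count E (λ x → P x ∧ Q x)  ≡⟨ countIn-∪-∩ P Q (elements E) ⟩
      count E P + count E Q                                  ∎
      where open ≤-Reasoning

    count-∪-∩-≤ : ∀ P Q U V → (∀ {x} → T (P x ∨ Q x) → T (U x)) → (∀ {x} → T (P x ∧ Q x) → T (V x)) →
      count E P + count E Q ≤ count E U + count E V
    count-∪-∩-≤ P Q U V P∪Q⊆U P∩Q⊆V = begin
      count E P + count E Q                                  ≡⟨ countIn-∪-∩ P Q (elements E) ⟨
      count E (λ x → P x ∨ Q x) + count E (λ x → P x ∧ Q x)  ≤⟨ +-mono-≤ (count-mono _ U P∪Q⊆U) (count-mono _ V P∩Q⊆V) ⟩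
      count E U + count E V                                  ∎
      where open ≤-Reasoning

    choose : (A → Bool) → A → A
    choose P fallback with any? (T? ∘ P) (elements E)
    ... | yes ∃P = proj₁ (satisfied ∃P)
    ... | no _ = fallback

    choose-spec : ∀ P fallback {x} → T (P x) → T (P (choose P fallback))
    choose-spec P fallback {x} Px with any? (T? ∘ P) (elements E)
    ... | yes ∃P = proj₂ (satisfied ∃P)
    ... | no ∄P = contradiction (lose (complete E x) Px) ∄P

module Vectors (𝔾 : FinAbGroup) where

  open import Level using (0ℓ)
  open import Algebra.Bundles using (AbelianGroup)
  open import Algebra.Structures using (IsAbelianGroup)
  import Algebra.Properties.AbelianGroup as AbelianGroupProperties
  import Algebra.Properties.CommutativeSemigroup as CommutativeSemigroupProperties
  open import Data.Nat using (ℕ; zero; suc)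
  open import Data.List using (List; []; _∷_; _++_; allFin; concatMap; cartesianProductWith)
  import Data.List as List
  open import Data.List.Relation.Unary.Any using (here)
  open import Data.List.Membership.Propositional using (_∈_)
  open import Data.List.Membership.Propositional.Properties using (∈-cartesianProductWith⁺; ∈-allFin)
  open import Data.List.Relation.Unary.Unique.Propositional using (Unique)
  import Data.List.Relation.Unary.Unique.Propositional.Properties as Unique
  import Data.List.Relation.Unary.All as ListAll
  import Data.List.Relation.Unary.AllPairs as AllPairs
  open import Data.Vec using (Vec; []; _∷_; replicate; map)
  open import Data.Vec.Properties
  open import Data.Product using (_,_)
  open import Relation.Binary.PropositionalEquality

  open Counting
  open FinAbGroup 𝔾
  open Ops 𝔾

  concatMap-map≡cartesianProductWith : ∀ {A B C : Set} (f : A → B → C) xs ys →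
    concatMap (λ x → List.map (f x) ys) xs ≡ cartesianProductWith f xs ys
  concatMap-map≡cartesianProductWith f [] ys = refl
  concatMap-map≡cartesianProductWith f (x ∷ xs) ys = cong (List.map (f x) ys ++_) (concatMap-map≡cartesianProductWith f xs ys)

  powEnumeration : ∀ k → Enumeration (Pow k)
  powEnumeration k = record { elements = allPow k ; unique = unique k ; complete = complete }
    where
    unique : ∀ k → Unique (allPow k)
    unique zero = ListAll.[] AllPairs.∷ AllPairs.[]
    unique (suc k) = subst Unique (sym (concatMap-map≡cartesianProductWith _∷_ (allFin N) (allPow k)))
      (Unique.cartesianProductWith⁺ _∷_ ∷-injective (Unique.allFin⁺ N) (unique k))
    complete : ∀ {k} (v : Pow k) → v ∈ allPow k
    complete [] = here refl
    complete {suc k} (x ∷ v) = subst (x ∷ v ∈_) (sym (concatMap-map≡cartesianProductWith _∷_ (allFin N) (allPow k)))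
      (∈-cartesianProductWith⁺ _∷_ (∈-allFin x) (complete v))

  0ᵛ : ∀ {k} → Pow k
  0ᵛ = replicate _ ε

  negᵛ : ∀ {k} → Pow k → Pow k
  negᵛ = map ⊖_

  powAbelianGroup : ℕ → AbelianGroup 0ℓ 0ℓ
  powAbelianGroup k = record
    { Carrier = Pow k
    ; _≈_ = _≡_
    ; _∙_ = _+ᵛ_
    ; ε = 0ᵛ
    ; _⁻¹ = negᵛ
    ; isAbelianGroup = record
      { isGroup = record
        { isMonoid = record
          { isSemigroup = record
            { isMagma = record { isEquivalence = isEquivalence ; ∙-cong = cong₂ _+ᵛ_ }
            ; assoc = zipWith-assoc assoc
            }
          ; identity = zipWith-identityˡ identityˡ , zipWith-identityʳ identityʳ
          }
        ; inverse = zipWith-inverseˡ inverseˡ , zipWith-inverseʳ inverseʳ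
        ; ⁻¹-cong = cong negᵛ
        }
      ; comm = zipWith-comm comm
      }
    }
    where open IsAbelianGroup isAbelianGroup using (assoc; comm; identityˡ; identityʳ; inverseˡ; inverseʳ)

  module Powᴳ {k} = AbelianGroup (powAbelianGroup k)
  module Powᴾ {k} = AbelianGroupProperties (powAbelianGroup k)
  module Powᶜ {k} = CommutativeSemigroupProperties (AbelianGroup.commutativeSemigroup (powAbelianGroup k))

  module _ {k : ℕ} where
    open Powᴳ {k} using (assoc; comm)
    open Powᴾ {k} using (//-rightDividesˡ; //-rightDividesʳ; ⁻¹-anti-homo-//)
    open ≡-Reasoning

    x-y≡x+negy : (x y : Pow k) → x -ᵛ y ≡ x +ᵛ negᵛ y
    x-y≡x+negy x y = sym (zipWith-map₂ _⊕_ ⊖_ x y)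

    x-y+y≡x : (x y : Pow k) → (x -ᵛ y) +ᵛ y ≡ x
    x-y+y≡x x y = trans (cong (_+ᵛ y) (x-y≡x+negy x y)) (//-rightDividesˡ y x)

    x+y-y≡x : (x y : Pow k) → (x +ᵛ y) -ᵛ y ≡ x
    x+y-y≡x x y = trans (x-y≡x+negy (x +ᵛ y) y) (//-rightDividesʳ y x)

    neg[x-y]≡y-x : (x y : Pow k) → negᵛ (x -ᵛ y) ≡ y -ᵛ x
    neg[x-y]≡y-x x y = begin
      negᵛ (x -ᵛ y)       ≡⟨ cong negᵛ (x-y≡x+negy x y) ⟩
      negᵛ (x +ᵛ negᵛ y)  ≡⟨ ⁻¹-anti-homo-// x y ⟩
      y +ᵛ negᵛ x         ≡⟨ x-y≡x+negy y x ⟨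
      y -ᵛ x              ∎

    [x-z]-[y-z]≡x-y : (x y z : Pow k) → (x -ᵛ z) -ᵛ (y -ᵛ z) ≡ x -ᵛ y
    [x-z]-[y-z]≡x-y x y z = begin
      (x -ᵛ z) -ᵛ (y -ᵛ z)          ≡⟨ x-y≡x+negy (x -ᵛ z) (y -ᵛ z) ⟩
      (x -ᵛ z) +ᵛ negᵛ (y -ᵛ z)     ≡⟨ cong ((x -ᵛ z) +ᵛ_) (neg[x-y]≡y-x y z) ⟩
      (x -ᵛ z) +ᵛ (z -ᵛ y)          ≡⟨ cong ((x -ᵛ z) +ᵛ_) (x-y≡x+negy z y) ⟩
      (x -ᵛ z) +ᵛ (z +ᵛ negᵛ y)     ≡⟨ assoc (x -ᵛ z) z (negᵛ y) ⟨
      ((x -ᵛ z) +ᵛ z) +ᵛ negᵛ y     ≡⟨ cong (_+ᵛ negᵛ y) (x-y+y≡x x z) ⟩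
      x +ᵛ negᵛ y                   ≡⟨ x-y≡x+negy x y ⟨
      x -ᵛ y                        ∎

    x-[x-y]≡y : (x y : Pow k) → x -ᵛ (x -ᵛ y) ≡ y
    x-[x-y]≡y x y = begin
      x -ᵛ (x -ᵛ y)                ≡⟨ cong (_-ᵛ (x -ᵛ y)) (x-y+y≡x x y) ⟨
      ((x -ᵛ y) +ᵛ y) -ᵛ (x -ᵛ y)  ≡⟨ cong (_-ᵛ (x -ᵛ y)) (comm (x -ᵛ y) y) ⟩
      (y +ᵛ (x -ᵛ y)) -ᵛ (x -ᵛ y)  ≡⟨ x+y-y≡x y (x -ᵛ y) ⟩
      y                            ∎

    +ᵛ-cancelʳ : ∀ z {x y : Pow k} → x +ᵛ z ≡ y +ᵛ z → x ≡ y
    +ᵛ-cancelʳ z {x} {y} eq = trans (sym (x+y-y≡x x z)) (trans (cong (_-ᵛ z) eq) (x+y-y≡x y z))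

    -ᵛ-cancelʳ : ∀ z {x y : Pow k} → x -ᵛ z ≡ y -ᵛ z → x ≡ y
    -ᵛ-cancelʳ z {x} {y} eq = trans (sym (x-y+y≡x x z)) (trans (cong (_+ᵛ z) eq) (x-y+y≡x y z))

    -ᵛ-cancelˡ : ∀ x {y z : Pow k} → x -ᵛ y ≡ x -ᵛ z → y ≡ z
    -ᵛ-cancelˡ x {y} {z} eq = trans (sym (x-[x-y]≡y x y)) (trans (cong (x -ᵛ_) eq) (x-[x-y]≡y x z))

module Blocks (𝔾 : FinAbGroup) where

  open import Data.Nat using (ℕ; zero; suc; _+_; _≤_; z≤n; s≤s)
  open import Data.Vec using (Vec; []; _∷_; [_]; zipWith; replicate; _++_; take; drop; head)
  open import Data.Vec.Properties
    using (++-injective; take++drop≡id; take-zipWith; drop-zipWith; zipWith-++; zipWith-replicate)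
  open import Data.Vec.Relation.Unary.All using (All; []; _∷_)
  open import Data.Product using (_×_; _,_; proj₁; proj₂)
  open import Relation.Binary.PropositionalEquality using (_≡_; refl; cong; cong₂; sym; trans; module ≡-Reasoning)

  open Ops 𝔾

  module _ {A : Set} where

    take-++ : ∀ m {n} (xs : Vec A m) (ys : Vec A n) → take m (xs ++ ys) ≡ xs
    take-++ m xs ys = proj₁ (++-injective (take m (xs ++ ys)) xs (take++drop≡id m (xs ++ ys)))

    drop-++ : ∀ m {n} (xs : Vec A m) (ys : Vec A n) → drop m (xs ++ ys) ≡ ys
    drop-++ m xs ys = proj₂ (++-injective (take m (xs ++ ys)) xs (take++drop≡id m (xs ++ ys)))

  diagV-zipWith : ∀ (f : G → G → G) {n} (ms : Vec ℕ n) b c →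
    diagV ms (zipWith f b c) ≡ zipWith f (diagV ms b) (diagV ms c)
  diagV-zipWith f [] [] [] = refl
  diagV-zipWith f (k ∷ ks) (b ∷ bs) (c ∷ cs) = begin
    replicate k (f b c) ++ diagV ks (zipWith f bs cs)
      ≡⟨ cong₂ _++_ (sym (zipWith-replicate f b c)) (diagV-zipWith f ks bs cs) ⟩
    zipWith f (replicate k b) (replicate k c) ++ zipWith f (diagV ks bs) (diagV ks cs)
      ≡⟨ zipWith-++ f (replicate k b) (diagV ks bs) (replicate k c) (diagV ks cs) ⟨
    zipWith f (replicate k b ++ diagV ks bs) (replicate k c ++ diagV ks cs) ∎
    where open ≡-Reasoning

  interleave-zipWith : ∀ (f : G → G → G) {n} (ms : Vec ℕ n) a a′ b b′ →
    interleave ms (zipWith f a a′) (zipWith f b b′) ≡ zipWith f (interleave ms a b) (interleave ms a′ b′)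
  interleave-zipWith f [] [] [] [] [] = refl
  interleave-zipWith f (k ∷ ks) a a′ (b ∷ bs) (b′ ∷ bs′) = begin
    block (zipWith f a a′) (f b b′) ++ rest (zipWith f a a′) (zipWith f bs bs′)
      ≡⟨ cong₂ _++_ block-zipWith rest-zipWith ⟩
    zipWith f (block a b) (block a′ b′) ++ zipWith f (rest a bs) (rest a′ bs′)
      ≡⟨ zipWith-++ f (block a b) (rest a bs) (block a′ b′) (rest a′ bs′) ⟨
    zipWith f (block a b ++ rest a bs) (block a′ b′ ++ rest a′ bs′) ∎
    where
    open ≡-Reasoning
    block : Pow (sumV (k ∷ ks)) → G → Pow (k + 1)
    block a b = take k a ++ [ b ]
    rest : Pow (sumV (k ∷ ks)) → Pow _ → Pow (sumV (incr ks))
    rest a bs = interleave ks (drop k a) bs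
    block-zipWith : block (zipWith f a a′) (f b b′) ≡ zipWith f (block a b) (block a′ b′)
    block-zipWith = trans (cong (_++ [ f b b′ ]) (take-zipWith f a a′))
                          (sym (zipWith-++ f (take k a) [ b ] (take k a′) [ b′ ]))
    rest-zipWith : rest (zipWith f a a′) (zipWith f bs bs′) ≡ zipWith f (rest a bs) (rest a′ bs′)
    rest-zipWith = trans (cong (λ w → interleave ks w (zipWith f bs bs′)) (drop-zipWith f a a′))
                         (interleave-zipWith f ks _ _ bs bs′)

  diagV-incr : ∀ {n} (ms : Vec ℕ n) c → diagV (incr ms) c ≡ interleave ms (diagV ms c) c
  diagV-incr [] [] = refl
  diagV-incr (k ∷ ks) (c ∷ cs) = cong₂ _++_
    (trans (replicate-+1 k) (cong (_++ [ c ]) (sym (take-++ k (replicate k c) (diagV ks cs)))))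
    (trans (diagV-incr ks cs) (cong (λ w → interleave ks w cs) (sym (drop-++ k (replicate k c) (diagV ks cs)))))
    where
    replicate-+1 : ∀ k → replicate (k + 1) c ≡ replicate k c ++ [ c ]
    replicate-+1 zero = refl
    replicate-+1 (suc k) = cong (c ∷_) (replicate-+1 k)

  deinterleave : ∀ {n} (ms : Vec ℕ n) → Pow (sumV (incr ms)) → Pow (sumV ms) × Pow n
  deinterleave [] [] = [] , []
  deinterleave (k ∷ ks) z =
    let block = take (k + 1) z
        a , b = deinterleave ks (drop (k + 1) z)
    in take k block ++ a , head (drop k block) ∷ b

  deinterleave-interleave : ∀ {n} (ms : Vec ℕ n) a b → deinterleave ms (interleave ms a b) ≡ (a , b)
  deinterleave-interleave [] [] [] = refl
  deinterleave-interleave (k ∷ ks) a (b ∷ bs)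
    rewrite take-++ (k + 1) (take k a ++ [ b ]) (interleave ks (drop k a) bs)
          | drop-++ (k + 1) (take k a ++ [ b ]) (interleave ks (drop k a) bs)
          | deinterleave-interleave ks (drop k a) bs
          | take-++ k (take k a) [ b ]
          | drop-++ k (take k a) [ b ]
          = cong (_, b ∷ bs) (take++drop≡id k a)

  undiagV : ∀ {n} (ms : Vec ℕ n) → All (1 ≤_) ms → Pow (sumV ms) → Pow n
  undiagV [] [] [] = []
  undiagV (suc k ∷ ks) (s≤s z≤n ∷ ps) (x ∷ xs) = x ∷ undiagV ks ps (drop k xs)

  undiagV-diagV : ∀ {n} (ms : Vec ℕ n) (ps : All (1 ≤_) ms) b → undiagV ms ps (diagV ms b) ≡ b
  undiagV-diagV [] [] [] = refl
  undiagV-diagV (suc k ∷ ks) (s≤s z≤n ∷ ps) (b ∷ bs) =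
    cong (b ∷_) (trans (cong (undiagV ks ps) (drop-++ k (replicate k b) (diagV ks bs))) (undiagV-diagV ks ps bs))

module Sumsets (𝔾 : FinAbGroup) where

  open import Data.Bool using (Bool; T; _∧_)
  open import Data.Bool.ListAction using (any)
  import Data.List.Relation.Unary.Any as Any
  open import Data.List.Relation.Unary.Any using (satisfied)
  open import Data.List.Relation.Unary.Any.Properties using (any⁺; any⁻)
  open import Data.List.Membership.Propositional using (lose) renaming (_∈_ to _∈ˡ_)
  open import Data.Nat using (ℕ; _≤_)
  open import Data.Nat.Properties using (≤-antisym)
  open import Data.List using (List)
  open import Data.Vec using (Vec)
  open import Data.Product using (∃; ∃₂; _×_; _,_)
  open import Function using (_∘_; id)
  open import Relation.Binary.PropositionalEquality
  open import Relation.Nullary.Decidable using (toWitness; fromWitness)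

  open Counting
  open Vectors 𝔾
  open Ops 𝔾

  private variable
    i j k : ℕ

  -- Neither T nor the any-based set formers of Defs determine their arguments, so the lemmas
  -- below take the sets involved as explicit arguments.
  infix 4 _∈_ _⊆_

  _∈_ : Pow k → Subset k → Set
  x ∈ X = T (X x)

  _⊆_ : Subset k → Subset k → Set
  X ⊆ Y = ∀ {x} → x ∈ X → x ∈ Y

  any-allPow⁺ : (p : Pow k → Bool) (x : Pow k) → T (p x) → T (any p (allPow k))
  any-allPow⁺ p x px = any⁺ p (lose (Enumeration.complete (powEnumeration _) x) px)

  any-allPow⁻ : (p : Pow k → Bool) → T (any p (allPow k)) → ∃ (T ∘ p)
  any-allPow⁻ {k} p = satisfied ∘ any⁻ p (allPow k)

  ==⁺ : {x y : Pow k} → x ≡ y → T (x == y)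
  ==⁺ = fromWitness

  ==⁻ : {x y : Pow k} → T (x == y) → x ≡ y
  ==⁻ = toWitness

  -- Definitionally, Diag ms = Image (diagV ms), and _+ˢ_, _-ˢ_, Prod ms are Image₂ of
  -- _+ᵛ_, _-ᵛ_, interleave ms.
  Image : (Pow i → Pow k) → Subset i → Subset k
  Image {i} f X z = any (λ x → X x ∧ (f x == z)) (allPow i)

  Image₂ : (Pow i → Pow j → Pow k) → Subset i → Subset j → Subset k
  Image₂ {i} {j} f X Y z = any (λ x → any (λ y → X x ∧ Y y ∧ (f x y == z)) (allPow j)) (allPow i)

  ∈-Image⁺ : ∀ (f : Pow i → Pow k) X {x} → x ∈ X → f x ∈ Image f X
  ∈-Image⁺ f X {x} x∈X = any-allPow⁺ (λ x′ → X x′ ∧ (f x′ == f x)) x (T-∧⁺ x∈X (==⁺ refl))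

  ∈-Image⁻ : ∀ (f : Pow i → Pow k) X {z} → z ∈ Image f X → ∃ λ x → x ∈ X × f x ≡ z
  ∈-Image⁻ f X {z} z∈ =
    let x , h = any-allPow⁻ (λ x → X x ∧ (f x == z)) z∈
        x∈X , fx≡z = T-∧⁻ (X x) h
    in x , x∈X , ==⁻ fx≡z

  ∈-Image₂⁺ : ∀ (f : Pow i → Pow j → Pow k) X Y {x y} → x ∈ X → y ∈ Y → f x y ∈ Image₂ f X Y
  ∈-Image₂⁺ {j = j} f X Y {x} {y} x∈X y∈Y =
    any-allPow⁺ (λ x′ → any (λ y′ → X x′ ∧ Y y′ ∧ (f x′ y′ == f x y)) (allPow j)) x
      (any-allPow⁺ (λ y′ → X x ∧ Y y′ ∧ (f x y′ == f x y)) y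
        (T-∧⁺ x∈X (T-∧⁺ y∈Y (==⁺ refl))))

  ∈-Image₂⁻ : ∀ (f : Pow i → Pow j → Pow k) X Y {z} → z ∈ Image₂ f X Y →
    ∃₂ λ x y → x ∈ X × y ∈ Y × f x y ≡ z
  ∈-Image₂⁻ {j = j} f X Y {z} z∈ =
    let x , h = any-allPow⁻ (λ x → any (λ y → X x ∧ Y y ∧ (f x y == z)) (allPow j)) z∈
        y , h′ = any-allPow⁻ (λ y → X x ∧ Y y ∧ (f x y == z)) h
        x∈X , h″ = T-∧⁻ (X x) h′
        y∈Y , fxy≡z = T-∧⁻ (Y y) h″
    in x , y , x∈X , y∈Y , ==⁻ fxy≡z

  module _ (X Y : Subset k) where

    ∈-sumset⁺ : ∀ {x y} → x ∈ X → y ∈ Y → x +ᵛ y ∈ X +ˢ Y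
    ∈-sumset⁺ = ∈-Image₂⁺ _+ᵛ_ X Y

    ∈-sumset⁻ : ∀ {z} → z ∈ X +ˢ Y → ∃₂ λ x y → x ∈ X × y ∈ Y × x +ᵛ y ≡ z
    ∈-sumset⁻ = ∈-Image₂⁻ _+ᵛ_ X Y

    ∈-diffset⁺ : ∀ {x y} → x ∈ X → y ∈ Y → x -ᵛ y ∈ X -ˢ Y
    ∈-diffset⁺ = ∈-Image₂⁺ _-ᵛ_ X Y

    ∈-diffset⁻ : ∀ {z} → z ∈ X -ˢ Y → ∃₂ λ x y → x ∈ X × y ∈ Y × x -ᵛ y ≡ z
    ∈-diffset⁻ = ∈-Image₂⁻ _-ᵛ_ X Y

  module _ {n} (ms : Vec ℕ n) where

    ∈-Diag⁺ : ∀ B {b} → b ∈ B → diagV ms b ∈ Diag ms B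
    ∈-Diag⁺ = ∈-Image⁺ (diagV ms)

    ∈-Diag⁻ : ∀ B {z} → z ∈ Diag ms B → ∃ λ b → b ∈ B × diagV ms b ≡ z
    ∈-Diag⁻ = ∈-Image⁻ (diagV ms)

    ∈-Prod⁺ : ∀ A B {a b} → a ∈ A → b ∈ B → interleave ms a b ∈ Prod ms A B
    ∈-Prod⁺ = ∈-Image₂⁺ (interleave ms)

    ∈-Prod⁻ : ∀ A B {z} → z ∈ Prod ms A B → ∃₂ λ a b → a ∈ A × b ∈ B × interleave ms a b ≡ z
    ∈-Prod⁻ = ∈-Image₂⁻ (interleave ms)

  card-injection : ∀ (X : Subset i) (Y : Subset k) (f : Pow i → Pow k) →
    (∀ {x} → x ∈ X → f x ∈ Y) → (∀ {x y} → x ∈ X → y ∈ X → f x ≡ f y → x ≡ y) → card X ≤ card Y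
  card-injection X Y = count-injection (powEnumeration _) (powEnumeration _) X Y

  card-mono : ∀ (X Y : Subset k) → X ⊆ Y → card X ≤ card Y
  card-mono X Y = count-mono (powEnumeration _) X Y

  +ˢ-mono : ∀ (X X′ Y Y′ : Subset k) → X ⊆ X′ → Y ⊆ Y′ → X +ˢ Y ⊆ X′ +ˢ Y′
  +ˢ-mono X X′ Y Y′ X⊆X′ Y⊆Y′ z∈ with ∈-sumset⁻ X Y z∈
  ... | x , y , x∈X , y∈Y , refl = ∈-sumset⁺ X′ Y′ (X⊆X′ x∈X) (Y⊆Y′ y∈Y)

  translate : Subset k → Pow k → Subset k
  translate X z w = X (w -ᵛ z)

  card-translate : ∀ (X : Subset k) z → card (translate X z) ≡ card X
  card-translate X z = ≤-antisym
    (card-injection (translate X z) X (_-ᵛ z) id (λ _ _ → -ᵛ-cancelʳ z))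
    (card-injection X (translate X z) (_+ᵛ z) (λ {x} → subst (_∈ X) (sym (x+y-y≡x x z))) (λ _ _ → +ᵛ-cancelʳ z))

  fromList : List (Pow k) → Subset k
  fromList zs w = any (_== w) zs

  ∈-fromList⁺ : ∀ {zs} {w : Pow k} → w ∈ˡ zs → w ∈ fromList zs
  ∈-fromList⁺ w∈zs = any⁺ _ (lose w∈zs (==⁺ refl))

  ∈-fromList⁻ : ∀ zs {w : Pow k} → w ∈ fromList zs → w ∈ˡ zs
  ∈-fromList⁻ zs = Any.map (sym ∘ ==⁻) ∘ any⁻ _ zs

  card-+ˢ-congʳ : ∀ (X Z Z′ : Subset k) → Z ⊆ Z′ → Z′ ⊆ Z → card (X +ˢ Z) ≡ card (X +ˢ Z′)
  card-+ˢ-congʳ X Z Z′ Z⊆Z′ Z′⊆Z =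
    ≤-antisym (card-mono (X +ˢ Z) (X +ˢ Z′) (+ˢ-mono X X Z Z′ id Z⊆Z′))
              (card-mono (X +ˢ Z′) (X +ˢ Z) (+ˢ-mono X X Z′ Z id Z′⊆Z))

  ∣A+Z∣≤∣[A+X]+Z∣ : ∀ (A X Z : Subset k) {x₀} → x₀ ∈ X → card (A +ˢ Z) ≤ card ((A +ˢ X) +ˢ Z)
  ∣A+Z∣≤∣[A+X]+Z∣ A X Z {x₀} x₀∈X =
    card-injection (A +ˢ Z) ((A +ˢ X) +ˢ Z) (_+ᵛ x₀) maps (λ _ _ → +ᵛ-cancelʳ x₀)
    where
    maps : ∀ {w} → w ∈ A +ˢ Z → w +ᵛ x₀ ∈ (A +ˢ X) +ˢ Z
    maps w∈ with ∈-sumset⁻ A Z w∈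
    ... | a , z , a∈A , z∈Z , refl =
      subst (_∈ (A +ˢ X) +ˢ Z) (Powᶜ.xy∙z≈xz∙y a x₀ z) (∈-sumset⁺ (A +ˢ X) Z (∈-sumset⁺ A X a∈A x₀∈X) z∈Z)

module Ruzsa (𝔾 : FinAbGroup) {n : ℕ} (ms : Vec ℕ n) where

  open import Data.Bool using (Bool; T; _∧_)
  open import Data.Nat using (_≤_; _*_)
  open import Data.Nat.Properties using (≤-antisym)
  open import Data.Product using (∃; ∃₂; _×_; _,_; proj₁; proj₂; uncurry)
  open import Function using (_∘_)
  open import Relation.Binary.PropositionalEquality

  open Counting
  open Vectors 𝔾
  open Blocks 𝔾
  open Sumsets 𝔾
  open Ops 𝔾

  private
    ℰ : ∀ {k} → Enumeration (Pow k)
    ℰ = powEnumeration _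

    m : ℕ
    m = sumV ms

    Δ : Pow n → Pow m
    Δ = diagV ms

    Δ⁺ : Pow n → Pow (sumV (incr ms))
    Δ⁺ = diagV (incr ms)

    I : Pow m → Pow n → Pow (sumV (incr ms))
    I = interleave ms

  [a-Δc]-Δ[b-c]≡a-Δb : ∀ a b c → (a -ᵛ Δ c) -ᵛ Δ (b -ᵛ c) ≡ a -ᵛ Δ b
  [a-Δc]-Δ[b-c]≡a-Δb a b c = begin
    (a -ᵛ Δ c) -ᵛ Δ (b -ᵛ c)     ≡⟨ cong ((a -ᵛ Δ c) -ᵛ_) (diagV-zipWith _ ms b c) ⟩
    (a -ᵛ Δ c) -ᵛ (Δ b -ᵛ Δ c)   ≡⟨ [x-z]-[y-z]≡x-y a (Δ b) (Δ c) ⟩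
    a -ᵛ Δ b                     ∎
    where open ≡-Reasoning

  interleave-shift : ∀ a b c → I (a -ᵛ Δ c) (b -ᵛ c) ≡ I a b -ᵛ Δ⁺ c
  interleave-shift a b c = trans (interleave-zipWith _ ms a (Δ c) b c) (cong (I a b -ᵛ_) (sym (diagV-incr ms c)))

  interleave-injective : ∀ {a a′ b b′} → I a b ≡ I a′ b′ → (a , b) ≡ (a′ , b′)
  interleave-injective {a} {a′} {b} {b′} eq = begin
    (a , b)                       ≡⟨ deinterleave-interleave ms a b ⟨
    deinterleave ms (I a b)       ≡⟨ cong (deinterleave ms) eq ⟩
    deinterleave ms (I a′ b′)     ≡⟨ deinterleave-interleave ms a′ b′ ⟩
    (a′ , b′)                     ∎
    where open ≡-Reasoning

  ∈-[-Diag]⁻ : ∀ A B {x} → x ∈ A -ˢ Diag ms B → ∃₂ λ a b → a ∈ A × b ∈ B × a -ᵛ Δ b ≡ x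
  ∈-[-Diag]⁻ A B x∈ with ∈-diffset⁻ A (Diag ms B) x∈
  ... | a , d , a∈A , d∈ΔB , refl with ∈-Diag⁻ ms B d∈ΔB
  ... | b , b∈B , refl = a , b , a∈A , b∈B , refl

  ∈-[-Diag]⁺ : ∀ A B {a b} → a ∈ A → b ∈ B → a -ᵛ Δ b ∈ A -ˢ Diag ms B
  ∈-[-Diag]⁺ A B a∈A b∈B = ∈-diffset⁺ A (Diag ms B) a∈A (∈-Diag⁺ ms B b∈B)

  ∈-[Prod-Diag]⁺ : ∀ A B C {a b c} → a ∈ A → b ∈ B → c ∈ C → I a b -ᵛ Δ⁺ c ∈ Prod ms A B -ˢ Diag (incr ms) C
  ∈-[Prod-Diag]⁺ A B C a∈A b∈B c∈C =
    ∈-diffset⁺ (Prod ms A B) (Diag (incr ms) C) (∈-Prod⁺ ms A B a∈A b∈B) (∈-Diag⁺ (incr ms) C c∈C)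

  ∈-[Prod-Diag]⁻ : ∀ A B C {z} → z ∈ Prod ms A B -ˢ Diag (incr ms) C →
    ∃₂ λ a b → ∃ λ c → a ∈ A × b ∈ B × c ∈ C × I a b -ᵛ Δ⁺ c ≡ z
  ∈-[Prod-Diag]⁻ A B C z∈ with ∈-diffset⁻ (Prod ms A B) (Diag (incr ms) C) z∈
  ... | p , d , p∈ , d∈ , refl with ∈-Prod⁻ ms A B p∈ | ∈-Diag⁻ (incr ms) C d∈
  ... | a , b , a∈A , b∈B , refl | c , c∈C , refl = a , b , c , a∈A , b∈B , c∈C , refl

  module Representation (A : Subset m) (B : Subset n) where

    private
      represents : Pow m → Pow m × Pow n → Bool
      represents x (a , b) = A a ∧ B b ∧ ((a -ᵛ Δ b) == x)

    representation : Pow m → Pow m × Pow n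
    representation x = choose (ℰ ×ᴱ ℰ) (represents x) (x , 0ᵛ)

    representation-spec : ∀ {x} → x ∈ A -ˢ Diag ms B →
      let a , b = representation x in a ∈ A × b ∈ B × a -ᵛ Δ b ≡ x
    representation-spec {x} x∈ with ∈-[-Diag]⁻ A B x∈
    ... | a , b , a∈A , b∈B , a-Δb≡x
      with choose-spec (ℰ ×ᴱ ℰ) (represents x) (x , 0ᵛ) {a , b}
             (T-∧⁺ a∈A (T-∧⁺ b∈B (==⁺ a-Δb≡x)))
    ... | h with T-∧⁻ (A (proj₁ (representation x))) h
    ... | a∈A′ , h′ with T-∧⁻ (B (proj₂ (representation x))) h′
    ... | b∈B′ , eq = a∈A′ , b∈B′ , ==⁻ eq

  module _ (A : Subset m) (B C : Subset n) where

    open Representation A B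

    ruzsaMap : Pow n × Pow m → Pow m × Pow n
    ruzsaMap (c , x) = let a , b = representation x in a -ᵛ Δ c , b -ᵛ c

    private
      Dom : Pow n × Pow m → Bool
      Dom = C ×ᵇ (A -ˢ Diag ms B)

    ruzsaMap-injective : ∀ {p p′} → T (Dom p) → T (Dom p′) → ruzsaMap p ≡ ruzsaMap p′ → p ≡ p′
    ruzsaMap-injective {c , x} {c′ , x′} p∈ p′∈ eq = cong₂ _,_ c≡c′ x≡x′
      where
      open ≡-Reasoning
      a = proj₁ (representation x)
      b = proj₂ (representation x)
      a′ = proj₁ (representation x′)
      b′ = proj₂ (representation x′)
      x∈ : x ∈ A -ˢ Diag ms B
      x∈ = proj₂ (×ᵇ⁻ C (A -ˢ Diag ms B) p∈)
      x′∈ : x′ ∈ A -ˢ Diag ms B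
      x′∈ = proj₂ (×ᵇ⁻ C (A -ˢ Diag ms B) p′∈)
      x≡x′ : x ≡ x′
      x≡x′ = begin
        x                              ≡⟨ proj₂ (proj₂ (representation-spec x∈)) ⟨
        a -ᵛ Δ b                       ≡⟨ [a-Δc]-Δ[b-c]≡a-Δb a b c ⟨
        (a -ᵛ Δ c) -ᵛ Δ (b -ᵛ c)       ≡⟨ cong (λ (u , v) → u -ᵛ Δ v) eq ⟩
        (a′ -ᵛ Δ c′) -ᵛ Δ (b′ -ᵛ c′)   ≡⟨ [a-Δc]-Δ[b-c]≡a-Δb a′ b′ c′ ⟩
        a′ -ᵛ Δ b′                     ≡⟨ proj₂ (proj₂ (representation-spec x′∈)) ⟩
        x′                             ∎
      c≡c′ : c ≡ c′
      c≡c′ = -ᵛ-cancelˡ b (trans (cong proj₂ eq) (cong (λ x → proj₂ (representation x) -ᵛ c′) (sym x≡x′)))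

    ruzsaMap-maps : ∀ {p} → T (Dom p) → let u , v = ruzsaMap p in
      u ∈ A -ˢ Diag ms C × v ∈ B -ˢ C × I u v ∈ Prod ms A B -ˢ Diag (incr ms) C
    ruzsaMap-maps {c , x} p∈ =
      let c∈C , x∈ = ×ᵇ⁻ C (A -ˢ Diag ms B) p∈
          a∈A , b∈B , _ = representation-spec x∈
          a , b = representation x
      in ∈-[-Diag]⁺ A C a∈A c∈C , ∈-diffset⁺ B C b∈B c∈C ,
         subst (_∈ Prod ms A B -ˢ Diag (incr ms) C) (sym (interleave-shift a b c)) (∈-[Prod-Diag]⁺ A B C a∈A b∈B c∈C)

    ∣C∣∣A-ΔB∣≤∣A-ΔC∣∣B-C∣ : card C * card (A -ˢ Diag ms B) ≤ card (A -ˢ Diag ms C) * card (B -ˢ C)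
    ∣C∣∣A-ΔB∣≤∣A-ΔC∣∣B-C∣ =
      subst₂ _≤_ (count-× ℰ ℰ C (A -ˢ Diag ms B)) (count-× ℰ ℰ (A -ˢ Diag ms C) (B -ˢ C))
        (count-injection (ℰ ×ᴱ ℰ) (ℰ ×ᴱ ℰ) Dom ((A -ˢ Diag ms C) ×ᵇ (B -ˢ C)) ruzsaMap
          (λ p∈ → let u∈ , v∈ , _ = ruzsaMap-maps p∈ in T-∧⁺ u∈ v∈) ruzsaMap-injective)

    ∣C∣∣A-ΔB∣≤∣A×B-Δ⁺C∣ : card C * card (A -ˢ Diag ms B) ≤ card (Prod ms A B -ˢ Diag (incr ms) C)
    ∣C∣∣A-ΔB∣≤∣A×B-Δ⁺C∣ =
      subst (_≤ card (Prod ms A B -ˢ Diag (incr ms) C)) (count-× ℰ ℰ C (A -ˢ Diag ms B))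
        (count-injection (ℰ ×ᴱ ℰ) ℰ Dom (Prod ms A B -ˢ Diag (incr ms) C) (uncurry I ∘ ruzsaMap)
          (proj₂ ∘ proj₂ ∘ ruzsaMap-maps) (λ p∈ p′∈ → ruzsaMap-injective p∈ p′∈ ∘ interleave-injective))

  swapShift : Pow (sumV (incr ms)) → Pow (sumV (incr ms))
  swapShift z = let u , v = deinterleave ms z in I (u -ᵛ Δ v) (negᵛ v)

  swapShift-shift : ∀ a b c → swapShift (I a b -ᵛ Δ⁺ c) ≡ I a c -ᵛ Δ⁺ b
  swapShift-shift a b c = begin
    swapShift (I a b -ᵛ Δ⁺ c)                        ≡⟨ cong swapShift (interleave-shift a b c) ⟨
    swapShift (I (a -ᵛ Δ c) (b -ᵛ c))                ≡⟨ cong (λ (u , v) → I (u -ᵛ Δ v) (negᵛ v)) (deinterleave-interleave ms _ _) ⟩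
    I ((a -ᵛ Δ c) -ᵛ Δ (b -ᵛ c)) (negᵛ (b -ᵛ c))     ≡⟨ cong₂ I ([a-Δc]-Δ[b-c]≡a-Δb a b c) (neg[x-y]≡y-x b c) ⟩
    I (a -ᵛ Δ b) (c -ᵛ b)                            ≡⟨ interleave-shift a c b ⟩
    I a c -ᵛ Δ⁺ b                                    ∎
    where open ≡-Reasoning

  module _ (A : Subset m) (B C : Subset n) where

    swapShift-maps : ∀ {z} → z ∈ Prod ms A B -ˢ Diag (incr ms) C → swapShift z ∈ Prod ms A C -ˢ Diag (incr ms) B
    swapShift-maps z∈ with ∈-[Prod-Diag]⁻ A B C z∈
    ... | a , b , c , a∈A , b∈B , c∈C , refl =
      subst (_∈ Prod ms A C -ˢ Diag (incr ms) B) (sym (swapShift-shift a b c)) (∈-[Prod-Diag]⁺ A C B a∈A c∈C b∈B)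

    swapShift-involutive : ∀ {z} → z ∈ Prod ms A B -ˢ Diag (incr ms) C → swapShift (swapShift z) ≡ z
    swapShift-involutive z∈ with ∈-[Prod-Diag]⁻ A B C z∈
    ... | a , b , c , _ , _ , _ , refl = trans (cong swapShift (swapShift-shift a b c)) (swapShift-shift a c b)

  ∣A×B-Δ⁺C∣≡∣A×C-Δ⁺B∣ : ∀ A B C → card (Prod ms A B -ˢ Diag (incr ms) C) ≡ card (Prod ms A C -ˢ Diag (incr ms) B)
  ∣A×B-Δ⁺C∣≡∣A×C-Δ⁺B∣ A B C = ≤-antisym (swapShift-card-≤ A B C) (swapShift-card-≤ A C B)
    where
    swapShift-card-≤ : ∀ A B C → card (Prod ms A B -ˢ Diag (incr ms) C) ≤ card (Prod ms A C -ˢ Diag (incr ms) B)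
    swapShift-card-≤ A B C = card-injection _ _ swapShift (swapShift-maps A B C)
      (λ z∈ z′∈ eq → trans (sym (swapShift-involutive A B C z∈))
                           (trans (cong swapShift eq) (swapShift-involutive A B C z′∈)))

module Petridis (𝔾 : FinAbGroup) {k : ℕ} (Y : Ops.Subset 𝔾 k) where

  open import Data.Bool using (T; _∧_; _∨_; not)
  open import Data.Bool.Properties using (T-∨; T-≡)
  open import Data.Bool.ListAction using (all)
  open import Data.List using ([]; _∷_; filter)
  open import Data.List.Membership.Propositional.Properties using (∈-filter⁺; ∈-filter⁻)
  import Data.List.Relation.Unary.All as All
  open import Data.List.Relation.Unary.All.Properties using (all⁺; all⁻)
  open import Data.Nat using (zero; suc; _+_; _*_; _≤_; _<_; z≤n; s≤s; _≤?_; _<?_; >-nonZero)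
  open import Data.Nat.Properties
    using ( +-cancelʳ-≤; *-cancelʳ-≤; +-monoˡ-≤; +-monoʳ-≤; *-monoˡ-≤; *-monoʳ-≤; *-distribˡ-+; *-comm; *-zeroʳ
          ; ≰⇒>; <-irrefl; ≤-antisym; ≤-refl; <⇒≤; m<n⇒0<n; *-commutativeSemigroup; module ≤-Reasoning)
  open import Algebra.Properties.CommutativeSemigroup *-commutativeSemigroup using (xy∙z≈xz∙y; xy∙z≈y∙xz; x∙yz≈yx∙z)
  open import Data.Nat.Induction using (<-wellFounded)
  open import Induction.WellFounded using (Acc; acc)
  open import Data.Product using (∃; _×_; _,_; proj₁; proj₂)
  open import Data.Sum using (_⊎_; inj₁; inj₂)
  open import Function using (id; _∘_; Equivalence)
  open import Relation.Binary.PropositionalEquality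
  open import Relation.Nullary using (yes; no; contradiction)
  open import Relation.Nullary.Decidable using (T?)

  open Counting
  open Vectors 𝔾
  open Sumsets 𝔾
  open Ops 𝔾

  Petridis : Subset k → Subset k → Set
  Petridis X Z = card X * card ((Y +ˢ X) +ˢ Z) ≤ card (Y +ˢ X) * card (X +ˢ Z)

  infix 4 _≼_ _≺_

  _≼_ : Subset k → Subset k → Set
  X′ ≼ X = card (Y +ˢ X′) * card X ≤ card (Y +ˢ X) * card X′

  _≺_ : Subset k → Subset k → Set
  X′ ≺ X = card (Y +ˢ X′) * card X < card (Y +ˢ X) * card X′

  HasSmallerRatio : Subset k → Set
  HasSmallerRatio X = ∃ λ W → W ⊆ X × W ≺ X

  insert : Pow k → Subset k → Subset k
  insert z Z w = (z == w) ∨ Z w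

  module _ (z : Pow k) (Z : Subset k) where

    ∈-insert-here : z ∈ insert z Z
    ∈-insert-here = Equivalence.from (T-∨ {z == z}) (inj₁ (==⁺ refl))

    ∈-insert-there : Z ⊆ insert z Z
    ∈-insert-there {w} = Equivalence.from (T-∨ {z == w}) ∘ inj₂

    ∈-insert⁻ : ∀ {w} → w ∈ insert z Z → z ≡ w ⊎ w ∈ Z
    ∈-insert⁻ {w} w∈ with Equivalence.to (T-∨ {z == w}) w∈
    ... | inj₁ z==w = inj₁ (==⁻ z==w)
    ... | inj₂ w∈Z = inj₂ w∈Z

  covered : Subset k → Subset k → Pow k → Subset k
  covered X Z z x = X x ∧ all (λ y → not (Y y) ∨ ((Y +ˢ X) +ˢ Z) ((y +ᵛ x) +ᵛ z)) (allPow k)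

  module _ {X Z : Subset k} {z : Pow k} where

    covered⁺ : ∀ {x} → x ∈ X → (∀ {y} → y ∈ Y → (y +ᵛ x) +ᵛ z ∈ (Y +ˢ X) +ˢ Z) → x ∈ covered X Z z
    covered⁺ {x} x∈X cover = T-∧⁺ x∈X (all⁻ _ {allPow k} (All.tabulate (λ {y} _ → T-not-∨⁺ (Y y) cover)))

    covered⁻ : ∀ {x} → x ∈ covered X Z z → x ∈ X × (∀ {y} → y ∈ Y → (y +ᵛ x) +ᵛ z ∈ (Y +ˢ X) +ˢ Z)
    covered⁻ {x} x∈W =
      let x∈X , h = T-∧⁻ (X x) x∈W
      in x∈X , λ {y} → T-not-∨⁻ (Y y) (All.lookup (all⁺ _ (allPow k) h) (Enumeration.complete (powEnumeration k) y))

  -- With W = covered X Z z, inserting z into Z adds at most ∣Y + X∣ - ∣Y + W∣ elements to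
  -- (Y + X) + Z (all in the translate (Y + X) + z, and not in (Y + W) + z) and at least
  -- ∣X∣ - ∣W∣ elements to X + Z (the translate (X ∖ W) + z); this is Petridis' induction step.
  module Insert (X Z : Subset k) (z : Pow k) where

    private
      W = covered X Z z
      ℰ = powEnumeration k

    card-[Y+X]+insert : card ((Y +ˢ X) +ˢ insert z Z) + card (Y +ˢ W) ≤ card ((Y +ˢ X) +ˢ Z) + card (Y +ˢ X)
    card-[Y+X]+insert =
      subst₂ (λ r′ r → card ((Y +ˢ X) +ˢ insert z Z) + r′ ≤ card ((Y +ˢ X) +ˢ Z) + r)
        (card-translate (Y +ˢ W) z) (card-translate (Y +ˢ X) z)
        (count-≤-∪-∩ ℰ ((Y +ˢ X) +ˢ insert z Z) (translate (Y +ˢ W) z) ((Y +ˢ X) +ˢ Z) (translate (Y +ˢ X) z)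
          new-sums-are-translates covered-translates-are-old)
      where
      new-sums-are-translates : ∀ {w} → w ∈ (Y +ˢ X) +ˢ insert z Z → T (((Y +ˢ X) +ˢ Z) w ∨ translate (Y +ˢ X) z w)
      new-sums-are-translates w∈ with ∈-sumset⁻ (Y +ˢ X) (insert z Z) w∈
      ... | s , z′ , s∈ , z′∈ , refl with ∈-insert⁻ z Z z′∈
      ...   | inj₁ refl = Equivalence.from T-∨ (inj₂ (subst (_∈ Y +ˢ X) (sym (x+y-y≡x s z)) s∈))
      ...   | inj₂ z′∈Z = Equivalence.from T-∨ (inj₁ (∈-sumset⁺ (Y +ˢ X) Z s∈ z′∈Z))
      covered-translates-are-old : ∀ {w} → w ∈ translate (Y +ˢ W) z → T (((Y +ˢ X) +ˢ Z) w ∧ translate (Y +ˢ X) z w)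
      covered-translates-are-old {w} w-z∈ with ∈-sumset⁻ Y W w-z∈
      ... | y , x , y∈Y , x∈W , y+x≡w-z =
        T-∧⁺ (subst (_∈ (Y +ˢ X) +ˢ Z) (trans (cong (_+ᵛ z) y+x≡w-z) (x-y+y≡x w z)) (proj₂ (covered⁻ x∈W) y∈Y))
             (+ˢ-mono Y Y W X id (proj₁ ∘ covered⁻) w-z∈)

    card-X+insert : card (X +ˢ Z) + card X ≤ card (X +ˢ insert z Z) + card W
    card-X+insert =
      subst₂ (λ q q′ → card (X +ˢ Z) + q ≤ card (X +ˢ insert z Z) + q′)
        (card-translate X z) (card-translate W z)
        (count-∪-∩-≤ ℰ (X +ˢ Z) (translate X z) (X +ˢ insert z Z) (translate W z) sums-in-insert old-translates-covered)
      where
      sums-in-insert : ∀ {w} → T ((X +ˢ Z) w ∨ translate X z w) → w ∈ X +ˢ insert z Z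
      sums-in-insert {w} h with Equivalence.to T-∨ h
      ... | inj₁ w∈X+Z = +ˢ-mono X X Z (insert z Z) id (∈-insert-there z Z) w∈X+Z
      ... | inj₂ w-z∈X = subst (_∈ X +ˢ insert z Z) (x-y+y≡x w z) (∈-sumset⁺ X (insert z Z) w-z∈X (∈-insert-here z Z))
      old-translates-covered : ∀ {w} → T ((X +ˢ Z) w ∧ translate X z w) → w ∈ translate W z
      old-translates-covered {w} h with T-∧⁻ ((X +ˢ Z) w) h
      ... | w∈X+Z , w-z∈X with ∈-sumset⁻ X Z w∈X+Z
      ...   | x′ , z′ , x′∈X , z′∈Z , refl = covered⁺ w-z∈X λ {y} y∈Y →
              subst (_∈ (Y +ˢ X) +ˢ Z) (sym (shift y)) (∈-sumset⁺ (Y +ˢ X) Z (∈-sumset⁺ Y X y∈Y x′∈X) z′∈Z)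
        where
        shift : ∀ y → (y +ᵛ ((x′ +ᵛ z′) -ᵛ z)) +ᵛ z ≡ (y +ᵛ x′) +ᵛ z′
        shift y = begin
          (y +ᵛ ((x′ +ᵛ z′) -ᵛ z)) +ᵛ z   ≡⟨ Powᴳ.assoc y _ z ⟩
          y +ᵛ (((x′ +ᵛ z′) -ᵛ z) +ᵛ z)   ≡⟨ cong (y +ᵛ_) (x-y+y≡x (x′ +ᵛ z′) z) ⟩
          y +ᵛ (x′ +ᵛ z′)                 ≡⟨ Powᴳ.assoc y x′ z′ ⟨
          (y +ᵛ x′) +ᵛ z′                 ∎
          where open ≡-Reasoning

    petridis-insert : Petridis X Z → X ≼ W → Petridis X (insert z Z)
    petridis-insert petridis X≼W = +-cancelʳ-≤ (∣X∣ * ∣Y+W∣) (∣X∣ * u) (∣Y+X∣ * v) (begin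
      ∣X∣ * u + ∣X∣ * ∣Y+W∣             ≡⟨ *-distribˡ-+ ∣X∣ u ∣Y+W∣ ⟨
      ∣X∣ * (u + ∣Y+W∣)                 ≤⟨ *-monoʳ-≤ ∣X∣ card-[Y+X]+insert ⟩
      ∣X∣ * (u′ + ∣Y+X∣)                ≡⟨ *-distribˡ-+ ∣X∣ u′ ∣Y+X∣ ⟩
      ∣X∣ * u′ + ∣X∣ * ∣Y+X∣            ≤⟨ +-monoˡ-≤ (∣X∣ * ∣Y+X∣) petridis ⟩
      ∣Y+X∣ * v′ + ∣X∣ * ∣Y+X∣          ≡⟨ cong (∣Y+X∣ * v′ +_) (*-comm ∣X∣ ∣Y+X∣) ⟩
      ∣Y+X∣ * v′ + ∣Y+X∣ * ∣X∣          ≡⟨ *-distribˡ-+ ∣Y+X∣ v′ ∣X∣ ⟨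
      ∣Y+X∣ * (v′ + ∣X∣)                ≤⟨ *-monoʳ-≤ ∣Y+X∣ card-X+insert ⟩
      ∣Y+X∣ * (v + ∣W∣)                 ≡⟨ *-distribˡ-+ ∣Y+X∣ v ∣W∣ ⟩
      ∣Y+X∣ * v + ∣Y+X∣ * ∣W∣           ≤⟨ +-monoʳ-≤ (∣Y+X∣ * v) X≼W ⟩
      ∣Y+X∣ * v + ∣Y+W∣ * ∣X∣           ≡⟨ cong (∣Y+X∣ * v +_) (*-comm ∣Y+W∣ ∣X∣) ⟩
      ∣Y+X∣ * v + ∣X∣ * ∣Y+W∣           ∎)
      where
      open ≤-Reasoning
      ∣X∣ = card X
      ∣W∣ = card W
      ∣Y+X∣ = card (Y +ˢ X)
      ∣Y+W∣ = card (Y +ˢ W)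
      u = card ((Y +ˢ X) +ˢ insert z Z)
      u′ = card ((Y +ˢ X) +ˢ Z)
      v = card (X +ˢ insert z Z)
      v′ = card (X +ˢ Z)

  petridis-or-smaller-fromList : ∀ X zs → Petridis X (fromList zs) ⊎ HasSmallerRatio X
  petridis-or-smaller-fromList X [] = inj₁ (subst (_≤ card (Y +ˢ X) * card (X +ˢ fromList [])) (sym lhs≡0) z≤n)
    where
    lhs≡0 : card X * card ((Y +ˢ X) +ˢ fromList []) ≡ 0
    lhs≡0 = trans (cong (card X *_) (count-none (powEnumeration k) ((Y +ˢ X) +ˢ fromList [])
              (λ {w} w∈ → let _ , _ , _ , ∈[] , _ = ∈-sumset⁻ (Y +ˢ X) (fromList []) {w} w∈ in ∈[])))
            (*-zeroʳ (card X))
  petridis-or-smaller-fromList X (z ∷ zs) with petridis-or-smaller-fromList X zs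
  ... | inj₂ smaller = inj₂ smaller
  ... | inj₁ petridis with card (Y +ˢ X) * card W ≤? card (Y +ˢ W) * card X
    where W = covered X (fromList zs) z
  ...   | yes X≼W = inj₁ (Insert.petridis-insert X (fromList zs) z petridis X≼W)
  ...   | no X⋠W = inj₂ (covered X (fromList zs) z , proj₁ ∘ covered⁻ , ≰⇒> X⋠W)

  petridis-or-smaller : ∀ X Z → Petridis X Z ⊎ HasSmallerRatio X
  petridis-or-smaller X Z with petridis-or-smaller-fromList X zs
    where zs = filter (accepts? Z) (allPow k)
  ... | inj₂ smaller = inj₂ smaller
  ... | inj₁ petridis = inj₁ (subst₂ (λ u v → card X * u ≤ card (Y +ˢ X) * v)
          (card-+ˢ-congʳ (Y +ˢ X) (fromList zs) Z zs⊆Z Z⊆zs) (card-+ˢ-congʳ X (fromList zs) Z zs⊆Z Z⊆zs) petridis)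
    where
    zs = filter (accepts? Z) (allPow k)
    zs⊆Z : fromList zs ⊆ Z
    zs⊆Z w∈ = Equivalence.from T-≡ (proj₂ (∈-filter⁻ (accepts? Z) {xs = allPow k} (∈-fromList⁻ zs w∈)))
    Z⊆zs : Z ⊆ fromList zs
    Z⊆zs {w} w∈Z = ∈-fromList⁺ (∈-filter⁺ (accepts? Z) (Enumeration.complete (powEnumeration k) w) (Equivalence.to T-≡ w∈Z))

  0<m*n⇒0<n : ∀ m {n} → 0 < m * n → 0 < n
  0<m*n⇒0<n m {suc n} _ = s≤s z≤n
  0<m*n⇒0<n m {zero} 0<m*0 = contradiction (subst (0 <_) (*-zeroʳ m) 0<m*0) λ ()

  ≼-trans : ∀ {X″ X′ X} → 0 < card X′ → X″ ≼ X′ → X′ ≼ X → X″ ≼ X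
  ≼-trans {X″} {X′} {X} 0<∣X′∣ X″≼X′ X′≼X = *-cancelʳ-≤ (a * u) (c * s) t {{>-nonZero 0<∣X′∣}} (begin
    (a * u) * t   ≡⟨ xy∙z≈xz∙y a u t ⟩
    (a * t) * u   ≤⟨ *-monoˡ-≤ u X″≼X′ ⟩
    (b * s) * u   ≡⟨ xy∙z≈y∙xz b s u ⟩
    s * (b * u)   ≤⟨ *-monoʳ-≤ s X′≼X ⟩
    s * (c * t)   ≡⟨ x∙yz≈yx∙z s c t ⟩
    (c * s) * t   ∎)
    where
    open ≤-Reasoning
    a = card (Y +ˢ X″)
    s = card X″
    b = card (Y +ˢ X′)
    t = card X′
    c = card (Y +ˢ X)
    u = card X

  smaller-ratio-proper : ∀ {W X} → W ⊆ X → W ≺ X → card W < card X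
  smaller-ratio-proper {W} {X} W⊆X W≺X with card W <? card X
  ... | yes ∣W∣<∣X∣ = ∣W∣<∣X∣
  ... | no ∣W∣≮∣X∣ =
    contradiction (subst₂ (λ v w → v * card X < card (Y +ˢ X) * w) ∣Y+W∣≡∣Y+X∣ ∣W∣≡∣X∣ W≺X) (<-irrefl refl)
    where
    X⊆W : X ⊆ W
    X⊆W {x} x∈X with T? (W x)
    ... | yes x∈W = x∈W
    ... | no x∉W = contradiction (count-< (powEnumeration k) W X W⊆X x∈X x∉W) ∣W∣≮∣X∣
    ∣W∣≡∣X∣ : card W ≡ card X
    ∣W∣≡∣X∣ = ≤-antisym (card-mono W X W⊆X) (card-mono X W X⊆W)
    ∣Y+W∣≡∣Y+X∣ : card (Y +ˢ W) ≡ card (Y +ˢ X)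
    ∣Y+W∣≡∣Y+X∣ = card-+ˢ-congʳ Y W X W⊆X X⊆W

  ratio-minimiser : ∀ X → 0 < card X → ∀ Z → ∃ λ X′ → X′ ⊆ X × 0 < card X′ × X′ ≼ X × Petridis X′ Z
  ratio-minimiser X 0<∣X∣ Z = go X 0<∣X∣ (<-wellFounded (card X))
    where
    go : ∀ X → 0 < card X → Acc _<_ (card X) → ∃ λ X′ → X′ ⊆ X × 0 < card X′ × X′ ≼ X × Petridis X′ Z
    go X 0<∣X∣ (acc rec) with petridis-or-smaller X Z
    ... | inj₁ petridis = X , id , 0<∣X∣ , ≤-refl , petridis
    ... | inj₂ (W , W⊆X , W≺X) =
      let 0<∣W∣ = 0<m*n⇒0<n (card (Y +ˢ X)) (m<n⇒0<n W≺X)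
          X′ , X′⊆W , 0<∣X′∣ , X′≼W , petridis = go W 0<∣W∣ (rec (smaller-ratio-proper W⊆X W≺X))
      in X′ , W⊆X ∘ X′⊆W , 0<∣X′∣ , ≼-trans 0<∣W∣ X′≼W (<⇒≤ W≺X) , petridis

module SumTriangle (𝔾 : FinAbGroup) {n : ℕ} (ms : Vec ℕ n) (ps : All (1 ≤_) ms) where

  open import Data.Nat using (zero; suc; _*_; _<_; z≤n; s≤s; >-nonZero)
  open import Data.Nat.Properties
    using (*-cancelʳ-≤; *-mono-≤; *-monoˡ-≤; *-monoʳ-≤; ≤-trans; *-commutativeSemigroup; module ≤-Reasoning)
  open import Algebra.Properties.CommutativeSemigroup *-commutativeSemigroup using (xy∙z≈x∙zy; x∙yz≈yx∙z; xy∙z≈xz∙y)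
  open import Data.Product using (_,_)
  open import Relation.Binary.PropositionalEquality

  open Counting
  open Vectors 𝔾
  open Blocks 𝔾
  open Sumsets 𝔾
  module P = Petridis 𝔾
  open FinAbGroup 𝔾 using (_⊕_)
  open Ops 𝔾

  private
    m : ℕ
    m = sumV ms

    Δ : Pow n → Pow m
    Δ = diagV ms

  diagV-undiagV : ∀ {S z} → z ∈ Diag ms S → Δ (undiagV ms ps z) ≡ z
  diagV-undiagV {S} z∈ with ∈-Diag⁻ ms S z∈
  ... | b , _ , refl = cong Δ (undiagV-diagV ms ps b)

  ∣S∣≤∣ΔS∣ : ∀ S → card S ≤ card (Diag ms S)
  ∣S∣≤∣ΔS∣ S = card-injection S (Diag ms S) Δ (∈-Diag⁺ ms S)
    (λ {b} {b′} _ _ eq → trans (sym (undiagV-diagV ms ps b)) (trans (cong (undiagV ms ps) eq) (undiagV-diagV ms ps b′)))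

  ∣X+ΔB∣≤∣B+C∣ : ∀ B C {X} → X ⊆ Diag ms C → card (X +ˢ Diag ms B) ≤ card (B +ˢ C)
  ∣X+ΔB∣≤∣B+C∣ B C {X} X⊆ΔC = card-injection (X +ˢ Diag ms B) (B +ˢ C) (undiagV ms ps) maps
    (λ w∈ w′∈ eq → trans (sym (diagV-undiagV {C +ˢ B} (X+ΔB⊆Δ[C+B] w∈)))
                         (trans (cong Δ eq) (diagV-undiagV {C +ˢ B} (X+ΔB⊆Δ[C+B] w′∈))))
    where
    X+ΔB⊆Δ[C+B] : X +ˢ Diag ms B ⊆ Diag ms (C +ˢ B)
    X+ΔB⊆Δ[C+B] w∈ with ∈-sumset⁻ X (Diag ms B) w∈
    ... | x , d , x∈X , d∈ΔB , refl with ∈-Diag⁻ ms C (X⊆ΔC x∈X) | ∈-Diag⁻ ms B d∈ΔB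
    ... | c , c∈C , refl | b , b∈B , refl =
      subst (_∈ Diag ms (C +ˢ B)) (diagV-zipWith _⊕_ ms c b) (∈-Diag⁺ ms (C +ˢ B) (∈-sumset⁺ C B c∈C b∈B))
    maps : ∀ {w} → w ∈ X +ˢ Diag ms B → undiagV ms ps w ∈ B +ˢ C
    maps w∈ with ∈-Diag⁻ ms (C +ˢ B) (X+ΔB⊆Δ[C+B] w∈)
    ... | s , s∈C+B , refl with ∈-sumset⁻ C B s∈C+B
    ... | c , b , c∈C , b∈B , refl =
      subst (_∈ B +ˢ C) (trans (Powᴳ.comm b c) (sym (undiagV-diagV ms ps (c +ᵛ b)))) (∈-sumset⁺ B C b∈B c∈C)

  ∣C∣∣A+ΔB∣≤∣A+ΔC∣∣B+C∣-nonempty : ∀ A B C → 0 < card C →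
    card C * card (A +ˢ Diag ms B) ≤ card (A +ˢ Diag ms C) * card (B +ˢ C)
  ∣C∣∣A+ΔB∣≤∣A+ΔC∣∣B+C∣-nonempty A B C 0<∣C∣
    with P.ratio-minimiser A (Diag ms C) (≤-trans 0<∣C∣ (∣S∣≤∣ΔS∣ C)) (Diag ms B)
  ... | X , X⊆ΔC , 0<∣X∣ , X≼ΔC , petridis with count-witness (powEnumeration m) X 0<∣X∣
  ... | x₀ , x₀∈X = *-cancelʳ-≤ (∣C∣ * ∣A+ΔB∣) (∣A+ΔC∣ * ∣B+C∣) ∣X∣ {{>-nonZero 0<∣X∣}} (begin
    (∣C∣ * ∣A+ΔB∣) * ∣X∣          ≤⟨ *-monoˡ-≤ ∣X∣ (*-mono-≤ (∣S∣≤∣ΔS∣ C) (∣A+Z∣≤∣[A+X]+Z∣ A X _ x₀∈X)) ⟩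
    (∣ΔC∣ * ∣[A+X]+ΔB∣) * ∣X∣     ≡⟨ xy∙z≈x∙zy ∣ΔC∣ ∣[A+X]+ΔB∣ ∣X∣ ⟩
    ∣ΔC∣ * (∣X∣ * ∣[A+X]+ΔB∣)     ≤⟨ *-monoʳ-≤ ∣ΔC∣ petridis ⟩
    ∣ΔC∣ * (∣A+X∣ * ∣X+ΔB∣)       ≡⟨ x∙yz≈yx∙z ∣ΔC∣ ∣A+X∣ ∣X+ΔB∣ ⟩
    (∣A+X∣ * ∣ΔC∣) * ∣X+ΔB∣       ≤⟨ *-mono-≤ X≼ΔC (∣X+ΔB∣≤∣B+C∣ B C X⊆ΔC) ⟩
    (∣A+ΔC∣ * ∣X∣) * ∣B+C∣        ≡⟨ xy∙z≈xz∙y ∣A+ΔC∣ ∣X∣ ∣B+C∣ ⟩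
    (∣A+ΔC∣ * ∣B+C∣) * ∣X∣        ∎)
    where
    open ≤-Reasoning
    ∣C∣ = card C
    ∣X∣ = card X
    ∣ΔC∣ = card (Diag ms C)
    ∣A+ΔB∣ = card (A +ˢ Diag ms B)
    ∣A+ΔC∣ = card (A +ˢ Diag ms C)
    ∣A+X∣ = card (A +ˢ X)
    ∣X+ΔB∣ = card (X +ˢ Diag ms B)
    ∣[A+X]+ΔB∣ = card ((A +ˢ X) +ˢ Diag ms B)
    ∣B+C∣ = card (B +ˢ C)

  ∣C∣∣A+ΔB∣≤∣A+ΔC∣∣B+C∣ : ∀ A B C → card C * card (A +ˢ Diag ms B) ≤ card (A +ˢ Diag ms C) * card (B +ˢ C)
  ∣C∣∣A+ΔB∣≤∣A+ΔC∣∣B+C∣ A B C with card C in ∣C∣≡c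
  ... | zero = z≤n
  ... | suc _ = subst (λ c → c * card (A +ˢ Diag ms B) ≤ card (A +ˢ Diag ms C) * card (B +ˢ C)) ∣C∣≡c
                  (∣C∣∣A+ΔB∣≤∣A+ΔC∣∣B+C∣-nonempty A B C (subst (0 <_) (sym ∣C∣≡c) (s≤s z≤n)))

lemma14 : (𝔾 : FinAbGroup) (n : ℕ) → 1 ≤ n → (ms : Vec ℕ n) → All (1 ≤_) ms →
    (A : Ops.Subset 𝔾 (Ops.sumV 𝔾 ms)) (B C : Ops.Subset 𝔾 n) →
      (Ops.card 𝔾 C * Ops.card 𝔾 (Ops._-ˢ_ 𝔾 A (Ops.Diag 𝔾 ms B))
        ≤ Ops.card 𝔾 (Ops._-ˢ_ 𝔾 (Ops.Prod 𝔾 ms A B) (Ops.Diag 𝔾 (Ops.incr 𝔾 ms) C)))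
      × (Ops.card 𝔾 (Ops._-ˢ_ 𝔾 (Ops.Prod 𝔾 ms A B) (Ops.Diag 𝔾 (Ops.incr 𝔾 ms) C))
        ≡ Ops.card 𝔾 (Ops._-ˢ_ 𝔾 (Ops.Prod 𝔾 ms A C) (Ops.Diag 𝔾 (Ops.incr 𝔾 ms) B)))
      × (Ops.card 𝔾 C * Ops.card 𝔾 (Ops._+ˢ_ 𝔾 A (Ops.Diag 𝔾 ms B))
        ≤ Ops.card 𝔾 (Ops._+ˢ_ 𝔾 A (Ops.Diag 𝔾 ms C)) * Ops.card 𝔾 (Ops._+ˢ_ 𝔾 B C))
      × (Ops.card 𝔾 C * Ops.card 𝔾 (Ops._-ˢ_ 𝔾 A (Ops.Diag 𝔾 ms B))
        ≤ Ops.card 𝔾 (Ops._-ˢ_ 𝔾 A (Ops.Diag 𝔾 ms C)) * Ops.card 𝔾 (Ops._-ˢ_ 𝔾 B C))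
lemma14 𝔾 _ _ ms ps A B C =
  Ruzsa.∣C∣∣A-ΔB∣≤∣A×B-Δ⁺C∣ 𝔾 ms A B C ,
  Ruzsa.∣A×B-Δ⁺C∣≡∣A×C-Δ⁺B∣ 𝔾 ms A B C ,
  SumTriangle.∣C∣∣A+ΔB∣≤∣A+ΔC∣∣B+C∣ 𝔾 ms ps A B C ,
  Ruzsa.∣C∣∣A-ΔB∣≤∣A-ΔC∣∣B-C∣ 𝔾 ms A B C
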